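{- Let $\mathcal{M}$ be a matroid of rank $r\ge 1$, let $k\ge 0$ be an integer, and let $B\subseteq E(\mathcal{M})$ be a set with $|B|=k+r$. Then $B$ is a $k$-fault-tolerant basis of $\mathcal{M}$ if and only if $B$ is $r$-uniform.
   Context: For a matroid $\mathcal{M}=(E,\mathcal{I})$ with rank function $\mathsf{rank}$ and a nonnegative integer $k$, a set $B\subseteq E$ is a $k$-fault-tolerant basis of $\mathcal{M}$ if $B$ is a set of minimum cardinality among all sets $B\subseteq E$ with the property that $\mathsf{rank}(B\setminus F)=\mathsf{rank}(\mathcal{M})$ for every $F\subseteq B$ with $|F|\le k$. For a positive integer $h$, a set $X\subseteq E$ is $h$-uniform if $\mathsf{rank}(X)=h$ and $\mathsf{rank}(Y)=h$ for every $Y\subseteq X$ with $|Y|=h$. -}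

module Defs where

open import Data.Nat using (ℕ; _≤_; _<_)
open import Data.Fin using (Fin)
open import Data.Fin.Subset using (Subset; _∈_; _∉_; _⊆_; _∪_; _─_; ⁅_⁆; ∣_∣)
open import Data.Fin.Subset using () renaming (⊥ to ∅)
open import Data.Product using (Σ; _×_; ∃)
open import Relation.Binary.PropositionalEquality using (_≡_)

record Matroid (n : ℕ) : Set₁ where
  field
    Indep      : Subset n → Set
    indep-∅    : Indep ∅
    indep-⊆    : ∀ {X Y} → Y ⊆ X → Indep X → Indep Y
    indep-aug  : ∀ {X Y} → Indep X → Indep Y → ∣ X ∣ < ∣ Y ∣ →
                 ∃ λ e → e ∈ Y × e ∉ X × Indep (X ∪ ⁅ e ⁆)

open Matroid public

HasRank : ∀ {n} → Matroid n → Subset n → ℕ → Set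
HasRank M X h =
  (Σ (Subset _) λ Y → Y ⊆ X × Indep M Y × ∣ Y ∣ ≡ h)
  × (∀ Y → Y ⊆ X → Indep M Y → ∣ Y ∣ ≤ h)

MatroidRank : ∀ {n} → Matroid n → ℕ → Set
MatroidRank M r = HasRank M Data.Fin.Subset.⊤ r

FaultTolerant : ∀ {n} → Matroid n → ℕ → ℕ → Subset n → Set
FaultTolerant M r k B = ∀ F → F ⊆ B → ∣ F ∣ ≤ k → HasRank M (B ─ F) r

FTBasis : ∀ {n} → Matroid n → ℕ → ℕ → Subset n → Set
FTBasis M r k B =
  FaultTolerant M r k B × (∀ B′ → FaultTolerant M r k B′ → ∣ B ∣ ≤ ∣ B′ ∣)

Uniform : ∀ {n} → Matroid n → ℕ → Subset n → Set
Uniform M h X = HasRank M X h × (∀ Y → Y ⊆ X → ∣ Y ∣ ≡ h → HasRank M Y h)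

-- A k-fault-tolerant set B contains an independent set I of size r, and deleting
-- all of B except r − 1 elements of I must leave rank r; this is impossible once
-- at most k elements are deleted, i.e. when |B| < k + r.  So every k-fault-tolerant
-- set has at least k + r elements.  For |B| = k + r, removing at most k elements
-- leaves at least r of them, and removing exactly k leaves exactly r: so fault
-- tolerance of B is the same as every r-subset of B having full rank r.
module Submission where

open import Defs
open import Data.Nat using (ℕ; zero; suc; _+_; _≤_; _≤?_; z≤n; s≤s)
open import Data.Nat.Properties
  using (+-suc; +-comm; +-cancelʳ-≤; +-monoʳ-≤; ≤-reflexive; ≰⇒>; n≤1+n; 1+n≰n; module ≤-Reasoning)
open import Data.Fin.Subset
  using (Subset; inside; outside; _⊆_; _─_; ∣_∣; ⊥)
open import Data.Fin.Subset.Properties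
  using (drop-∷-⊆; out⊆; s⊆s; ⊆-refl; ⊆-trans; ⊆⊤; ⊥⊆; ∣⊥∣≡0; p─⊥≡p; p─q⊆p; p⊆q⇒∣p∣≤∣q∣)
open import Data.Vec using ([]; _∷_; _[_]=_)
open import Data.Product using (∃; _×_; _,_; proj₁; proj₂)
open import Data.Empty using (⊥-elim)
open import Function.Bundles using (_⇔_; mk⇔)
open import Relation.Binary.PropositionalEquality using (_≡_; refl; cong; trans; sym; subst)
open import Relation.Nullary using (¬_; yes; no)

open _[_]=_ using (here)

private
  variable
    n : ℕ

∣p─q∣+∣q∣≡∣p∣ : (p q : Subset n) → q ⊆ p → ∣ p ─ q ∣ + ∣ q ∣ ≡ ∣ p ∣
∣p─q∣+∣q∣≡∣p∣ []            []            _   = refl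
∣p─q∣+∣q∣≡∣p∣ (inside  ∷ p) (outside ∷ q) q⊆p = cong suc (∣p─q∣+∣q∣≡∣p∣ p q (drop-∷-⊆ q⊆p))
∣p─q∣+∣q∣≡∣p∣ (outside ∷ p) (outside ∷ q) q⊆p = ∣p─q∣+∣q∣≡∣p∣ p q (drop-∷-⊆ q⊆p)
∣p─q∣+∣q∣≡∣p∣ (inside  ∷ p) (inside  ∷ q) q⊆p =
  trans (+-suc ∣ p ─ q ∣ ∣ q ∣) (cong suc (∣p─q∣+∣q∣≡∣p∣ p q (drop-∷-⊆ q⊆p)))
∣p─q∣+∣q∣≡∣p∣ (outside ∷ p) (inside  ∷ q) q⊆p with q⊆p here
... | ()

p─[p─q]≡q : (p q : Subset n) → q ⊆ p → p ─ (p ─ q) ≡ q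
p─[p─q]≡q []            []            _   = refl
p─[p─q]≡q (inside  ∷ p) (inside  ∷ q) q⊆p = cong (inside ∷_) (p─[p─q]≡q p q (drop-∷-⊆ q⊆p))
p─[p─q]≡q (inside  ∷ p) (outside ∷ q) q⊆p = cong (outside ∷_) (p─[p─q]≡q p q (drop-∷-⊆ q⊆p))
p─[p─q]≡q (outside ∷ p) (outside ∷ q) q⊆p = cong (outside ∷_) (p─[p─q]≡q p q (drop-∷-⊆ q⊆p))
p─[p─q]≡q (outside ∷ p) (inside  ∷ q) q⊆p with q⊆p here
... | ()

⊆-of-size : (p : Subset n) (m : ℕ) → m ≤ ∣ p ∣ → ∃ λ q → q ⊆ p × ∣ q ∣ ≡ m
⊆-of-size []            zero    _       = [] , ⊆-refl , refl
⊆-of-size (outside ∷ p) m       m≤∣p∣   with ⊆-of-size p m m≤∣p∣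
... | q , q⊆p , ∣q∣≡m = outside ∷ q , out⊆ q⊆p , ∣q∣≡m
⊆-of-size {suc n} (inside ∷ p) zero _   = ⊥ , ⊥⊆ , ∣⊥∣≡0 (suc n)
⊆-of-size (inside  ∷ p) (suc m) (s≤s m≤∣p∣) with ⊆-of-size p m m≤∣p∣
... | q , q⊆p , ∣q∣≡m = inside ∷ q , s⊆s q⊆p , cong suc ∣q∣≡m

module _ (M : Matroid n) where

  HasRank⇒≤∣∣ : ∀ {X h} → HasRank M X h → h ≤ ∣ X ∣
  HasRank⇒≤∣∣ {X} ((I , I⊆X , _ , ∣I∣≡h) , _) = subst (_≤ ∣ X ∣) ∣I∣≡h (p⊆q⇒∣p∣≤∣q∣ I⊆X)

  -- Only valid for r = rank(M): the upper bound comes from the whole ground set.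
  HasRank-⊇ : ∀ {r X Y} → MatroidRank M r → Y ⊆ X → HasRank M Y r → HasRank M X r
  HasRank-⊇ rank Y⊆X ((I , I⊆Y , indI , ∣I∣≡r) , _) =
    (I , ⊆-trans I⊆Y Y⊆X , indI , ∣I∣≡r) , λ J _ indJ → proj₂ rank J ⊆⊤ indJ

  FaultTolerant⇒HasRank : ∀ {r k B} → FaultTolerant M r k B → HasRank M B r
  FaultTolerant⇒HasRank {r} {k} {B} ft =
    subst (λ X → HasRank M X r) (p─⊥≡p B) (ft ⊥ ⊥⊆ (subst (_≤ k) (sym (∣⊥∣≡0 n)) z≤n))

  FaultTolerant⇒HasRank-⊆ : ∀ {r k B Y} → FaultTolerant M r k B →
                            Y ⊆ B → ∣ B ∣ ≤ k + ∣ Y ∣ → HasRank M Y r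
  FaultTolerant⇒HasRank-⊆ {r} {k} {B} {Y} ft Y⊆B ∣B∣≤k+∣Y∣ =
    subst (λ X → HasRank M X r) (p─[p─q]≡q B Y Y⊆B) (ft (B ─ Y) (p─q⊆p B Y) ∣B─Y∣≤k)
    where
    ∣B─Y∣≤k : ∣ B ─ Y ∣ ≤ k
    ∣B─Y∣≤k = +-cancelʳ-≤ ∣ Y ∣ (∣ B ─ Y ∣) k
      (subst (_≤ k + ∣ Y ∣) (sym (∣p─q∣+∣q∣≡∣p∣ B Y Y⊆B)) ∣B∣≤k+∣Y∣)

  FaultTolerant⇒Uniform : ∀ {r k B} → FaultTolerant M r k B → ∣ B ∣ ≤ k + r → Uniform M r B
  FaultTolerant⇒Uniform {r} {k} {B} ft ∣B∣≤k+r =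
    FaultTolerant⇒HasRank ft ,
    λ Y Y⊆B ∣Y∣≡r → FaultTolerant⇒HasRank-⊆ ft Y⊆B (subst (λ m → ∣ B ∣ ≤ k + m) (sym ∣Y∣≡r) ∣B∣≤k+r)

  Uniform⇒FaultTolerant : ∀ {r k B} → MatroidRank M r → Uniform M r B → k + r ≤ ∣ B ∣ →
                          FaultTolerant M r k B
  Uniform⇒FaultTolerant {r} {k} {B} rank (_ , uniform) k+r≤∣B∣ F F⊆B ∣F∣≤k
    with ⊆-of-size (B ─ F) r r≤∣B─F∣
    where
    r≤∣B─F∣ : r ≤ ∣ B ─ F ∣
    r≤∣B─F∣ = +-cancelʳ-≤ ∣ F ∣ r (∣ B ─ F ∣) (begin
      r + ∣ F ∣          ≤⟨ +-monoʳ-≤ r ∣F∣≤k ⟩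
      r + k              ≡⟨ +-comm r k ⟩
      k + r              ≤⟨ k+r≤∣B∣ ⟩
      ∣ B ∣              ≡⟨ sym (∣p─q∣+∣q∣≡∣p∣ B F F⊆B) ⟩
      ∣ B ─ F ∣ + ∣ F ∣  ∎)
      where open ≤-Reasoning
  ... | Y , Y⊆B─F , ∣Y∣≡r =
    HasRank-⊇ rank Y⊆B─F (uniform Y (⊆-trans Y⊆B─F (p─q⊆p B F)) ∣Y∣≡r)

  -- Keep only r − 1 elements of an independent r-set: the rest is at most k faults.
  short⇒¬FaultTolerant : ∀ {j k B} → ∣ B ∣ ≤ k + j → ¬ FaultTolerant M (suc j) k B
  short⇒¬FaultTolerant {j} {k} {B} ∣B∣≤k+j ft with proj₁ (FaultTolerant⇒HasRank ft)
  ... | I , I⊆B , _ , ∣I∣≡1+j with ⊆-of-size I j (subst (j ≤_) (sym ∣I∣≡1+j) (n≤1+n j))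
  ... | J , J⊆I , ∣J∣≡j = 1+n≰n (subst (suc j ≤_) ∣J∣≡j (HasRank⇒≤∣∣ J-full))
    where
    J-full : HasRank M J (suc j)
    J-full = FaultTolerant⇒HasRank-⊆ ft (⊆-trans J⊆I I⊆B)
               (subst (λ m → ∣ B ∣ ≤ k + m) (sym ∣J∣≡j) ∣B∣≤k+j)

  FaultTolerant⇒k+r≤∣∣ : ∀ {r k B} → 1 ≤ r → FaultTolerant M r k B → k + r ≤ ∣ B ∣
  FaultTolerant⇒k+r≤∣∣ {suc j} {k} {B} _ ft with ∣ B ∣ ≤? k + j
  ... | yes ∣B∣≤k+j = ⊥-elim (short⇒¬FaultTolerant ∣B∣≤k+j ft)
  ... | no  ∣B∣≰k+j = subst (_≤ ∣ B ∣) (sym (+-suc k j)) (≰⇒> ∣B∣≰k+j)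

mainTheorem6 : ∀ {n} (M : Matroid n) (r k : ℕ) (B : Subset n) →
    MatroidRank M r → 1 ≤ r → ∣ B ∣ ≡ k + r →
    FTBasis M r k B ⇔ Uniform M r B
mainTheorem6 M r k B rank 1≤r ∣B∣≡k+r = mk⇔
  (λ (ft , _) → FaultTolerant⇒Uniform M ft (≤-reflexive ∣B∣≡k+r))
  (λ uniform → Uniform⇒FaultTolerant M rank uniform (≤-reflexive (sym ∣B∣≡k+r))
             , λ B′ ft′ → subst (_≤ ∣ B′ ∣) (sym ∣B∣≡k+r) (FaultTolerant⇒k+r≤∣∣ M 1≤r ft′))
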